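{- Let \(m\) and \(M\) be positive integers with \(M/2<m<M\), and let \(Y\) be a subset of the open integer interval \((m,M)\). Then the submonoid \(\langle Y\cup\{m,M\}\rangle\) of \(\mathbb{N}\) generated by \(Y\cup\{m,M\}\) is a numerical semigroup with multiplicity \(m\) and maximum primitive \(M\) if and only if \(\gcd(Y\cup\{m,M\})=1\).
   Context: A numerical semigroup is a submonoid \(S\) of \((\mathbb{N},+)\) (with \(\mathbb{N}=\{0,1,2,\dots\}\)) whose complement in \(\mathbb{N}\) is finite. Its primitives (minimal generators) form the unique smallest generating set of \(S\); the multiplicity is the smallest primitive and the maximum primitive is the largest primitive. -}

module Defs where

open import Data.Nat using (ℕ; zero; suc; _+_; _<_; _≤_)
open import Data.Nat.GCD using (gcd)
open import Data.List using (List; foldr)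
open import Data.List.Membership.Propositional using (_∈_)
open import Data.Product using (_×_; ∃-syntax)
open import Relation.Nullary using (¬_)
open import Relation.Binary.PropositionalEquality using (_≡_)

SubsetOfℕ : Set₁
SubsetOfℕ = ℕ → Set

data ⟨_⟩ (G : List ℕ) : ℕ → Set where
  gen-zero : ⟨ G ⟩ 0
  gen-add  : ∀ {g x} → g ∈ G → ⟨ G ⟩ x → ⟨ G ⟩ (g + x)

IsSubmonoid : SubsetOfℕ → Set
IsSubmonoid S = S 0 × (∀ {a b} → S a → S b → S (a + b))

CofiniteComplement : SubsetOfℕ → Set
CofiniteComplement S = ∃[ F ] (∀ n → F < n → S n)

IsNumericalSemigroup : SubsetOfℕ → Set
IsNumericalSemigroup S = IsSubmonoid S × CofiniteComplement S

IsPrimitive : SubsetOfℕ → ℕ → Set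
IsPrimitive S x =
  S x × 0 < x × (∀ a b → S a → S b → 0 < a → 0 < b → ¬ (a + b ≡ x))

HasMultiplicity : SubsetOfℕ → ℕ → Set
HasMultiplicity S m = IsPrimitive S m × (∀ p → IsPrimitive S p → m ≤ p)

HasMaxPrimitive : SubsetOfℕ → ℕ → Set
HasMaxPrimitive S M = IsPrimitive S M × (∀ p → IsPrimitive S p → p ≤ M)

gcdList : List ℕ → ℕ
gcdList = foldr gcd 0

{-# OPTIONS --safe #-}
-- A finitely generated submonoid of ℕ is cofinite iff its generators have gcd 1:
-- Bézout's identity puts two consecutive numbers N, N + 1 in the monoid, and then
-- every n > N² is a combination of them; conversely the gcd divides every element.
-- If all generators lie in [m, M] with M < 2m, any sum of two nonzero elements is
-- at least 2m > M, so m and M are primitive; every primitive is a generator, hence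
-- lies in [m, M].
module Submission where

open import Defs
open import Data.Nat using (ℕ; zero; suc; _+_; _*_; _∸_; _<_; _≤_; z<s; NonZero)
open import Data.Nat.Properties
open import Data.Nat.Divisibility using (_∣_; _∣0; ∣-trans; ∣1⇒≡1; ∣m∣n⇒∣m+n; ∣m+n∣m⇒∣n)
open import Data.Nat.DivMod using (_/_; _%_; m≡m%n+[m/n]*n; m%n<n; m*n/n≡m; /-monoˡ-≤)
open import Data.Nat.GCD using (gcd; gcd[m,n]∣m; gcd[m,n]∣n; gcd-GCD; module Bézout)
open import Data.Nat.Solver using (module +-*-Solver)
open import Data.List using (List; []; _∷_)
open import Data.List.Relation.Unary.All using (All; _∷_)
import Data.List.Relation.Unary.All as All
open import Data.List.Relation.Unary.Any using (here; there)
open import Data.List.Membership.Propositional using (_∈_)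
open import Data.Product using (_×_; _,_; ∃-syntax)
open import Data.Empty using (⊥-elim)
open import Function.Bundles using (_⇔_; mk⇔; Equivalence)
open import Relation.Binary.PropositionalEquality
  using (_≡_; refl; sym; trans; cong; subst; module ≡-Reasoning)

private
  variable
    G : List ℕ
    S : SubsetOfℕ
    g m M x : ℕ

⟨⟩-+ : ∀ {a b} → ⟨ G ⟩ a → ⟨ G ⟩ b → ⟨ G ⟩ (a + b)
⟨⟩-+ gen-zero sb = sb
⟨⟩-+ {b = b} (gen-add {g} {x} g∈G sx) sb =
  subst ⟨ _ ⟩ (sym (+-assoc g x b)) (gen-add g∈G (⟨⟩-+ sx sb))

⟨⟩-isSubmonoid : IsSubmonoid ⟨ G ⟩
⟨⟩-isSubmonoid = gen-zero , ⟨⟩-+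

⟨⟩-∈ : g ∈ G → ⟨ G ⟩ g
⟨⟩-∈ {g} g∈G = subst ⟨ _ ⟩ (+-identityʳ g) (gen-add g∈G gen-zero)

⟨⟩-∷ : ⟨ G ⟩ x → ⟨ g ∷ G ⟩ x
⟨⟩-∷ gen-zero = gen-zero
⟨⟩-∷ (gen-add g∈G sx) = gen-add (there g∈G) (⟨⟩-∷ sx)

submonoid-* : IsSubmonoid S → ∀ k → S x → S (k * x)
submonoid-* (S0 , _) zero sx = S0
submonoid-* S-monoid@(_ , S+) (suc k) sx = S+ sx (submonoid-* S-monoid k sx)

⟨⟩-* : ∀ k → ⟨ G ⟩ x → ⟨ G ⟩ (k * x)
⟨⟩-* = submonoid-* ⟨⟩-isSubmonoid

gcdList∣∈ : g ∈ G → gcdList G ∣ g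
gcdList∣∈ {G = g ∷ G} (here refl) = gcd[m,n]∣m g (gcdList G)
gcdList∣∈ {G = h ∷ G} (there g∈G) = ∣-trans (gcd[m,n]∣n h (gcdList G)) (gcdList∣∈ g∈G)

gcdList∣⟨⟩ : ⟨ G ⟩ x → gcdList G ∣ x
gcdList∣⟨⟩ gen-zero = _ ∣0
gcdList∣⟨⟩ (gen-add g∈G sx) = ∣m∣n⇒∣m+n (gcdList∣∈ g∈G) (gcdList∣⟨⟩ sx)

⟨⟩-bézout : ∀ G → ∃[ N ] (⟨ G ⟩ N × ⟨ G ⟩ (N + gcdList G))
⟨⟩-bézout [] = 0 , gen-zero , gen-zero
⟨⟩-bézout (g ∷ G) with ⟨⟩-bézout G | Bézout.identity (gcd-GCD g (gcdList G))
... | N , sN , sN+e | Bézout.+- a b d+be≡ag =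
  b * (N + e) , ⟨⟩-* b (⟨⟩-∷ sN+e) , subst ⟨ g ∷ G ⟩ (sym shift) ag+bN
  where
  open ≡-Reasoning
  e d : ℕ
  e = gcdList G
  d = gcd g e
  ag+bN : ⟨ g ∷ G ⟩ (a * g + b * N)
  ag+bN = ⟨⟩-+ (⟨⟩-* a (⟨⟩-∈ (here refl))) (⟨⟩-* b (⟨⟩-∷ sN))
  shift : b * (N + e) + d ≡ a * g + b * N
  shift = begin
    b * (N + e) + d     ≡⟨ cong (_+ d) (*-distribˡ-+ b N e) ⟩
    b * N + b * e + d   ≡⟨ +-assoc (b * N) (b * e) d ⟩
    b * N + (b * e + d) ≡⟨ cong (b * N +_) (+-comm (b * e) d) ⟩
    b * N + (d + b * e) ≡⟨ cong (b * N +_) d+be≡ag ⟩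
    b * N + a * g       ≡⟨ +-comm (b * N) (a * g) ⟩
    a * g + b * N       ∎
... | N , sN , sN+e | Bézout.-+ a b d+ag≡be =
  a * g + b * N , ag+bN , subst ⟨ g ∷ G ⟩ (sym shift) (⟨⟩-* b (⟨⟩-∷ sN+e))
  where
  open ≡-Reasoning
  e d : ℕ
  e = gcdList G
  d = gcd g e
  ag+bN : ⟨ g ∷ G ⟩ (a * g + b * N)
  ag+bN = ⟨⟩-+ (⟨⟩-* a (⟨⟩-∈ (here refl))) (⟨⟩-* b (⟨⟩-∷ sN))
  shift : a * g + b * N + d ≡ b * (N + e)
  shift = begin
    a * g + b * N + d   ≡⟨ +-comm (a * g + b * N) d ⟩
    d + (a * g + b * N) ≡⟨ sym (+-assoc d (a * g) (b * N)) ⟩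
    d + a * g + b * N   ≡⟨ cong (_+ b * N) d+ag≡be ⟩
    b * e + b * N       ≡⟨ +-comm (b * e) (b * N) ⟩
    b * N + b * e       ≡⟨ *-distribˡ-+ b N e ⟨
    b * (N + e)         ∎

-- Division by N leaves a remainder r < N ≤ quotient q, and n = (q ∸ r) N + r (N + 1).
combination-of-consecutive : ∀ N n → .{{_ : NonZero N}} → N * N ≤ n →
                             ∃[ a ] ∃[ b ] n ≡ a * N + b * suc N
combination-of-consecutive N n N²≤n = q ∸ r , r , n≡
  where
  open ≡-Reasoning
  q r : ℕ
  q = n / N
  r = n % N
  r≤q : r ≤ q
  r≤q = <⇒≤ (<-≤-trans (m%n<n n N)
          (subst (_≤ q) (m*n/n≡m N N) (/-monoˡ-≤ N N²≤n)))
  n≡ : n ≡ (q ∸ r) * N + r * suc N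
  n≡ = begin
    n                       ≡⟨ m≡m%n+[m/n]*n n N ⟩
    r + q * N               ≡⟨ cong (λ t → r + t * N) (m∸n+n≡m r≤q) ⟨
    r + ((q ∸ r) + r) * N   ≡⟨ solve 3 (λ a r N → r :+ (a :+ r) :* N := a :* N :+ r :* (con 1 :+ N))
                                 refl (q ∸ r) r N ⟩
    (q ∸ r) * N + r * suc N ∎
    where open +-*-Solver

consecutive⇒cofinite : ∀ N → IsSubmonoid S → S N → S (suc N) → CofiniteComplement S
consecutive⇒cofinite {S} zero S-monoid _ S1 =
  0 , λ n _ → subst S (*-identityʳ n) (submonoid-* S-monoid n S1)
consecutive⇒cofinite {S} N@(suc _) S-monoid@(_ , S+) SN SN+1 = N * N , covered
  where
  covered : ∀ n → N * N < n → S n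
  covered n N²<n with combination-of-consecutive N n (<⇒≤ N²<n)
  ... | a , b , n≡ =
    subst S (sym n≡) (S+ (submonoid-* S-monoid a SN) (submonoid-* S-monoid b SN+1))

cofinite⇒consecutive : CofiniteComplement S → ∃[ n ] (S n × S (suc n))
cofinite⇒consecutive (F , cofinite) =
  suc F , cofinite (suc F) ≤-refl , cofinite (suc (suc F)) (m<n⇒m<1+n ≤-refl)

⟨⟩-isNumericalSemigroup⇔gcdList≡1 : IsNumericalSemigroup ⟨ G ⟩ ⇔ gcdList G ≡ 1
⟨⟩-isNumericalSemigroup⇔gcdList≡1 {G} = mk⇔ gcd≡1 numerical
  where
  gcd≡1 : IsNumericalSemigroup ⟨ G ⟩ → gcdList G ≡ 1
  gcd≡1 (_ , cofinite) with cofinite⇒consecutive cofinite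
  ... | n , sn , sn+1 = ∣1⇒≡1 (∣m+n∣m⇒∣n
          (subst (gcdList G ∣_) (+-comm 1 n) (gcdList∣⟨⟩ sn+1)) (gcdList∣⟨⟩ sn))
  numerical : gcdList G ≡ 1 → IsNumericalSemigroup ⟨ G ⟩
  numerical gcd≡1 with ⟨⟩-bézout G
  ... | N , sN , sN+gcd =
    ⟨⟩-isSubmonoid ,
    consecutive⇒cofinite N ⟨⟩-isSubmonoid sN
      (subst ⟨ G ⟩ (trans (cong (N +_) gcd≡1) (+-comm N 1)) sN+gcd)

primitive⇒∈ : IsPrimitive ⟨ G ⟩ x → x ∈ G
primitive⇒∈ (gen-zero , () , _)
primitive⇒∈ (gen-add {g} {zero} g∈G _ , _) = subst (_∈ _) (sym (+-identityʳ g)) g∈G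
primitive⇒∈ (gen-add {zero} _ sx , 0<x , indecomposable) = primitive⇒∈ (sx , 0<x , indecomposable)
primitive⇒∈ (gen-add {suc g} {suc x} g∈G sx , _ , indecomposable) =
  ⊥-elim (indecomposable (suc g) (suc x) (⟨⟩-∈ g∈G) sx z<s z<s refl)

⟨⟩-lowerBound : All (m ≤_) G → ⟨ G ⟩ x → 0 < x → m ≤ x
⟨⟩-lowerBound G≥m (gen-add {g} {x} g∈G _) _ = ≤-trans (All.lookup G≥m g∈G) (m≤m+n g x)

<2*lowerBound⇒primitive : All (m ≤_) G → ⟨ G ⟩ x → 0 < x → x < 2 * m → IsPrimitive ⟨ G ⟩ x
<2*lowerBound⇒primitive {m} {G} {x} G≥m sx 0<x x<2m = sx , 0<x , λ a b sa sb 0<a 0<b a+b≡x →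
  <⇒≱ x<2m (begin
    2 * m ≡⟨ cong (m +_) (+-identityʳ m) ⟩
    m + m ≤⟨ +-mono-≤ (⟨⟩-lowerBound G≥m sa 0<a) (⟨⟩-lowerBound G≥m sb 0<b) ⟩
    a + b ≡⟨ a+b≡x ⟩
    x     ∎)
  where open ≤-Reasoning

hasMultiplicity : All (m ≤_) G → m ∈ G → 0 < m → HasMultiplicity ⟨ G ⟩ m
hasMultiplicity {m} G≥m m∈G 0<m =
  <2*lowerBound⇒primitive G≥m (⟨⟩-∈ m∈G) 0<m (m<m+n m (<-≤-trans 0<m (m≤m+n m 0))) ,
  λ p (sp , 0<p , _) → ⟨⟩-lowerBound G≥m sp 0<p

hasMaxPrimitive : All (m ≤_) G → All (_≤ M) G → M ∈ G → 0 < M → M < 2 * m →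
                  HasMaxPrimitive ⟨ G ⟩ M
hasMaxPrimitive G≥m G≤M M∈G 0<M M<2m =
  <2*lowerBound⇒primitive G≥m (⟨⟩-∈ M∈G) 0<M M<2m ,
  λ p p-primitive → All.lookup G≤M (primitive⇒∈ p-primitive)

lemma2p2 : (m M : ℕ) → 0 < m → 0 < M → M < 2 * m → m < M →
           (Y : List ℕ) → All (λ y → m < y × y < M) Y →
           (IsNumericalSemigroup ⟨ m ∷ M ∷ Y ⟩
             × HasMultiplicity ⟨ m ∷ M ∷ Y ⟩ m
             × HasMaxPrimitive ⟨ m ∷ M ∷ Y ⟩ M)
           ⇔ (gcdList (m ∷ M ∷ Y) ≡ 1)
lemma2p2 m M 0<m 0<M M<2m m<M Y Y⊆⟨m,M⟩ = mk⇔
  (λ (numerical , _) → Equivalence.to numerical⇔gcd≡1 numerical)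
  (λ gcd≡1 →
    Equivalence.from numerical⇔gcd≡1 gcd≡1 ,
    hasMultiplicity G≥m (here refl) 0<m ,
    hasMaxPrimitive G≥m G≤M (there (here refl)) 0<M M<2m)
  where
  numerical⇔gcd≡1 : IsNumericalSemigroup ⟨ m ∷ M ∷ Y ⟩ ⇔ gcdList (m ∷ M ∷ Y) ≡ 1
  numerical⇔gcd≡1 = ⟨⟩-isNumericalSemigroup⇔gcdList≡1 {m ∷ M ∷ Y}
  G≥m : All (m ≤_) (m ∷ M ∷ Y)
  G≥m = ≤-refl ∷ <⇒≤ m<M ∷ All.map (λ (m<y , _) → <⇒≤ m<y) Y⊆⟨m,M⟩
  G≤M : All (_≤ M) (m ∷ M ∷ Y)
  G≤M = <⇒≤ m<M ∷ ≤-refl ∷ All.map (λ (_ , y<M) → <⇒≤ y<M) Y⊆⟨m,M⟩
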